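{- Let $G$ be a finite simple graph. Then $\dim_{\mathrm{poc}}(G)=1$ if and only if $G=K_{t+1}$ or $G=K_t\cup K_1$ (disjoint union) for some positive integer $t$.
   Context: For $\mathbf{x},\mathbf{y}\in\mathbb{R}^d$, $\mathbf{x}\prec\mathbf{y}$ means $x_i<y_i$ for all $i$. For finite $S\subseteq\mathbb{R}^d$, $D_S$ is the digraph on $S$ with an arc $(\mathbf{x},\mathbf{v})$ whenever $\mathbf{v}\prec\mathbf{x}$. By convention $\mathbb{R}^0$ consists of a single point, and a $0$-partial order is a digraph with exactly one vertex. The competition graph $C(D)$ of a digraph $D$ has vertex set $V(D)$ and an edge between distinct $x,y$ iff some $z$ has arcs $(x,z),(y,z)$. The partial order competition dimension $\dim_{\mathrm{poc}}(G)$ is the smallest nonnegative integer $d$ such that for some nonnegative integer $k$ and some finite $S\subseteq\mathbb{R}^d$, the disjoint union of $G$ and $k$ isolated vertices is isomorphic to $C(D_S)$. $K_n$ denotes the complete graph on $n$ vertices.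
   Formalization: The finite point sets S used to define $\dim_{\mathrm{poc}}(G)$ have rational coordinates, lying in ℚ^d rather than $\mathbb{R}^d$. -}

module Defs where

open import Data.Nat using (ℕ; _+_; _<_)
open import Data.Fin using (Fin; splitAt)
open import Data.Sum using (_⊎_; inj₁; inj₂)
open import Data.Product using (Σ; _×_; _,_)
open import Data.Empty using (⊥)
open import Data.Vec using (Vec; lookup)
open import Data.Rational using (ℚ) renaming (_<_ to _<ℚ_)
open import Relation.Nullary using (¬_)
open import Relation.Binary.PropositionalEquality using (_≡_; _≢_; refl; sym)
open import Function.Bundles using (_⤖_; Bijection; _⇔_)
open import Function.Definitions using (Injective)

record Graph : Set₁ where
  field
    n      : ℕ
    Adj    : Fin n → Fin n → Set
    adj-sym    : ∀ {x y} → Adj x y → Adj y x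
    adj-irrefl : ∀ {x} → ¬ Adj x x
open Graph public

record Digraph : Set₁ where
  field
    size : ℕ
    Arc  : Fin size → Fin size → Set
open Digraph public

record _≅_ (G H : Graph) : Set where
  field
    bij : Fin (n G) ⤖ Fin (n H)
    adj : ∀ x y → Adj G x y ⇔ Adj H (Bijection.to bij x) (Bijection.to bij y)

K : ℕ → Graph
K m = record { n = m ; Adj = λ x y → x ≢ y ; adj-sym = λ p q → p (sym q) ; adj-irrefl = λ p → p refl }

Empty : ℕ → Graph
Empty k = record { n = k ; Adj = λ _ _ → ⊥ ; adj-sym = λ () ; adj-irrefl = λ () }

unionAdj : ∀ {a b} → (Fin a → Fin a → Set) → (Fin b → Fin b → Set)
         → Fin a ⊎ Fin b → Fin a ⊎ Fin b → Set
unionAdj A B (inj₁ x) (inj₁ y) = A x y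
unionAdj A B (inj₂ x) (inj₂ y) = B x y
unionAdj A B (inj₁ _) (inj₂ _) = ⊥
unionAdj A B (inj₂ _) (inj₁ _) = ⊥

unionSym : (G H : Graph) → ∀ u v → unionAdj (Adj G) (Adj H) u v → unionAdj (Adj G) (Adj H) v u
unionSym G H (inj₁ x) (inj₁ y) e = Graph.adj-sym G e
unionSym G H (inj₂ x) (inj₂ y) e = Graph.adj-sym H e

unionIrr : (G H : Graph) → ∀ u → ¬ unionAdj (Adj G) (Adj H) u u
unionIrr G H (inj₁ x) = Graph.adj-irrefl G
unionIrr G H (inj₂ x) = Graph.adj-irrefl H

_∪_ : Graph → Graph → Graph
G ∪ H = record
  { n = n G + n H
  ; Adj = λ x y → unionAdj (Adj G) (Adj H) (splitAt (n G) x) (splitAt (n G) y)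
  ; adj-sym = λ {x} {y} → unionSym G H (splitAt (n G) x) (splitAt (n G) y)
  ; adj-irrefl = λ {x} → unionIrr G H (splitAt (n G) x)
  }

-- Competition graph C(D): x ~ y iff x ≠ y and they have a common out-neighbour.
CompAdj : (D : Digraph) → Fin (size D) → Fin (size D) → Set
CompAdj D x y = x ≢ y × Σ (Fin (size D)) (λ z → Arc D x z × Arc D y z)

C : Digraph → Graph
C D = record
  { n = size D
  ; Adj = CompAdj D
  ; adj-sym = λ { (ne , z , a , b) → (λ e → ne (sym e)) , z , b , a }
  ; adj-irrefl = λ { (ne , _) → ne refl }
  }

_≺_ : ∀ {d} → Vec ℚ d → Vec ℚ d → Set
_≺_ {d} x y = ∀ (i : Fin d) → lookup x i <ℚ lookup y i

-- D_S for a finite point set S = {p 0, …, p (m-1)} ⊆ ℚ^d (p injective):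
-- arc (x , v) whenever p v ≺ p x.
D : ∀ {d m} → (Fin m → Vec ℚ d) → Digraph
D {d} {m} p = record { size = m ; Arc = λ x v → p v ≺ p x }

Representable : Graph → ℕ → Set
Representable G d =
  Σ ℕ λ k → Σ ℕ λ m → Σ (Fin m → Vec ℚ d) λ p →
    Injective _≡_ _≡_ p × ((G ∪ Empty k) ≅ C (D p))

DimPoc : Graph → ℕ → Set
DimPoc G d = Representable G d × (∀ d′ → d′ < d → ¬ Representable G d′)

{-# OPTIONS --safe #-}
module Submission where

open import Defs
open import Data.Nat using (ℕ; zero; suc; _+_; _≤_; _≥_; _≤?_; s≤s; z≤n)
import Data.Nat.Properties as ℕ
open import Data.Nat.Coprimality using (1-coprimeTo) renaming (sym to coprime-sym)
open import Data.Fin using (Fin; zero; suc; toℕ; _↑ˡ_; _↑ʳ_; splitAt; cast)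
open import Data.Fin.Properties using (_≟_; ↑ˡ-injective; toℕ-injective; ¬Fin0; cantor-schröder-bernstein)
open import Data.Fin.Properties using (splitAt-↑ˡ; splitAt-↑ʳ; splitAt⁻¹-↑ˡ; splitAt⁻¹-↑ʳ)
open import Data.Fin.Permutation using (cast-id; transpose; _∘ₚ_)
import Data.Fin.Permutation.Components as PC
open import Data.Vec using (Vec; []; _∷_; lookup)
open import Data.Vec.Properties using (∷-injectiveˡ)
open import Data.Rational using (ℚ; mkℚ; ↥_) renaming (_<_ to _<ℚ_; _≤_ to _≤ℚ_)
import Data.Rational.Properties as ℚ
import Data.Integer.Properties as ℤ
open import Data.Integer using (+_)
open import Data.Product using (Σ; ∃; _×_; _,_; proj₁)
open import Data.Product.Function.NonDependent.Propositional using (_×-⇔_)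
open import Data.Sum using (_⊎_; inj₁; inj₂; [_,_]′)
open import Data.Empty using (⊥-elim)
open import Function using (_∘_)
open import Function.Bundles using (_⇔_; mk⇔; Equivalence; Bijection; Surjection; _⤖_)
open import Function.Definitions using (Injective)
open import Function.Properties.Inverse using (↔⇒⤖)
open import Function.Properties.Equivalence using (⇔-setoid)
open import Function.Construct.Identity using (⇔-id; ⤖-id)
open import Level using (0ℓ)
open import Relation.Nullary using (¬_; yes; no; contradiction; Irrelevant)
open import Relation.Binary.PropositionalEquality using (_≡_; _≢_; refl; sym; trans; cong; subst)
open import Relation.Binary.Reasoning.Setoid (⇔-setoid 0ℓ)

-- In dimension one the points of S are totally ordered, so in C(D_S) the lowest point
-- has no prey and is isolated, while any two other points share it as a common prey:
-- C(D_S) is K_{m-1} ∪ K_1.  Restricting to G (isolated vertices added to G carry no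
-- edges) forces G to be complete or complete plus one isolated vertex, and conversely
-- such a G becomes K_{m-1} ∪ K_1 after adding at most one isolated vertex.  Dimension
-- zero has a single point, so it represents exactly the graphs with at most one vertex.

Avoiding : ∀ {N} → Fin N → Fin N → Fin N → Set
Avoiding s x y = x ≢ y × x ≢ s × y ≢ s

IsComplete : Graph → Set
IsComplete G = ∀ x y → Adj G x y ⇔ x ≢ y

IsCompleteWithIsolated : (G : Graph) → Fin (n G) → Set
IsCompleteWithIsolated G s = ∀ x y → Adj G x y ⇔ Avoiding s x y

CompleteWithAtMostOneIsolated : Graph → Set
CompleteWithAtMostOneIsolated G = IsComplete G ⊎ ∃ (IsCompleteWithIsolated G)

K-complete : ∀ m → IsComplete (K m)
K-complete m x y = ⇔-id _

avoiding⇔≢ : ∀ {N} {s x y : Fin N} → x ≢ s → y ≢ s → Avoiding s x y ⇔ x ≢ y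
avoiding⇔≢ x≢s y≢s = mk⇔ proj₁ (λ x≢y → x≢y , x≢s , y≢s)

module _ {a b} {f : Fin a → Fin b} (f-injective : Injective _≡_ _≡_ f) where

  ≢⇔≢ : ∀ x y → x ≢ y ⇔ f x ≢ f y
  ≢⇔≢ x y = mk⇔ (λ x≢y → x≢y ∘ f-injective) (λ fx≢fy → fx≢fy ∘ cong f)

  avoiding⇔avoiding : ∀ s x y → Avoiding s x y ⇔ Avoiding (f s) (f x) (f y)
  avoiding⇔avoiding s x y = ≢⇔≢ x y ×-⇔ ≢⇔≢ x s ×-⇔ ≢⇔≢ y s

Fin-irrelevant : ∀ {N} → N ≤ 1 → Irrelevant (Fin N)
Fin-irrelevant {suc zero}    _           zero zero = refl
Fin-irrelevant {suc (suc _)} (s≤s ())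

Fin-distinct : ∀ {N} → 2 ≤ N → Σ (Fin N) λ x → Σ (Fin N) λ y → x ≢ y
Fin-distinct {suc zero}    (s≤s ())
Fin-distinct {suc (suc _)} _ = zero , suc zero , λ ()

2≤n⇔n≡t+1 : ∀ {N} → 2 ≤ N ⇔ (∃ λ t → t ≥ 1 × N ≡ t + 1)
2≤n⇔n≡t+1 = mk⇔ split (λ (t , t≥1 , N≡t+1) → subst (2 ≤_) (sym N≡t+1) (ℕ.+-monoˡ-≤ 1 t≥1))
  where
  split : ∀ {N} → 2 ≤ N → ∃ λ t → t ≥ 1 × N ≡ t + 1
  split {suc zero}    (s≤s ())
  split {suc (suc N)} _ = suc N , s≤s z≤n , sym (ℕ.+-comm (suc N) 1)

irrelevant⇒¬Adj : (G : Graph) → Irrelevant (Fin (n G)) → ∀ {x y} → ¬ Adj G x y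
irrelevant⇒¬Adj G G-single {x} {y} x~y with refl ← G-single x y = adj-irrefl G x~y

module _ {A B : Graph} (φ : A ≅ B) where
  open Bijection (_≅_.bij φ) using (to; injective; surjection)
  open Surjection surjection using (to⁻; to∘to⁻)

  ≅⇒size≡ : n A ≡ n B
  ≅⇒size≡ = cantor-schröder-bernstein injective to⁻-injective
    where
    to⁻-injective : Injective _≡_ _≡_ to⁻
    to⁻-injective {x} {y} e = trans (sym (to∘to⁻ x)) (trans (cong to e) (to∘to⁻ y))

  complete-pullback : IsComplete B → IsComplete A
  complete-pullback B-complete x y = begin
    Adj A x y            ≈⟨ _≅_.adj φ x y ⟩
    Adj B (to x) (to y)  ≈⟨ B-complete (to x) (to y) ⟩
    to x ≢ to y          ≈⟨ ≢⇔≢ injective x y ⟨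
    x ≢ y                ∎

  completeWithIsolated-pullback : ∀ {s} → IsCompleteWithIsolated B s → IsCompleteWithIsolated A (to⁻ s)
  completeWithIsolated-pullback {s} B-cwi x y = begin
    Adj A x y                            ≈⟨ _≅_.adj φ x y ⟩
    Adj B (to x) (to y)                  ≈⟨ B-cwi (to x) (to y) ⟩
    Avoiding s (to x) (to y)             ≡⟨ cong (λ s′ → Avoiding s′ (to x) (to y)) (to∘to⁻ s) ⟨
    Avoiding (to (to⁻ s)) (to x) (to y)  ≈⟨ avoiding⇔avoiding injective (to⁻ s) x y ⟨
    Avoiding (to⁻ s) x y                 ∎

transpose-sends : ∀ {N} (i j : Fin N) → PC.transpose i j i ≡ j
transpose-sends i j with i ≟ i
... | yes _   = refl
... | no i≢i  = contradiction refl i≢i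

module _ {A B : Graph} (size≡ : n A ≡ n B) where

  complete⇒≅ : IsComplete A → IsComplete B → A ≅ B
  complete⇒≅ A-complete B-complete = record { bij = π ; adj = adj }
    where
    π : Fin (n A) ⤖ Fin (n B)
    π = ↔⇒⤖ (cast-id size≡)
    open Bijection π using (to; injective)
    adj : ∀ x y → Adj A x y ⇔ Adj B (to x) (to y)
    adj x y = begin
      Adj A x y            ≈⟨ A-complete x y ⟩
      x ≢ y                ≈⟨ ≢⇔≢ injective x y ⟩
      to x ≢ to y          ≈⟨ B-complete (to x) (to y) ⟨
      Adj B (to x) (to y)  ∎

  completeWithIsolated⇒≅ : ∀ {s s′} → IsCompleteWithIsolated A s → IsCompleteWithIsolated B s′ →
                           A ≅ B
  completeWithIsolated⇒≅ {s} {s′} A-cwi B-cwi = record { bij = π ; adj = adj }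
    where
    π : Fin (n A) ⤖ Fin (n B)
    π = ↔⇒⤖ (cast-id size≡ ∘ₚ transpose (cast size≡ s) s′)
    open Bijection π using (to; injective)
    to-s : to s ≡ s′
    to-s = transpose-sends (cast size≡ s) s′
    adj : ∀ x y → Adj A x y ⇔ Adj B (to x) (to y)
    adj x y = begin
      Adj A x y                      ≈⟨ A-cwi x y ⟩
      Avoiding s x y                 ≈⟨ avoiding⇔avoiding injective s x y ⟩
      Avoiding (to s) (to x) (to y)  ≡⟨ cong (λ t → Avoiding t (to x) (to y)) to-s ⟩
      Avoiding s′ (to x) (to y)      ≈⟨ B-cwi (to x) (to y) ⟨
      Adj B (to x) (to y)            ∎

data SplitView (a b : ℕ) : Fin (a + b) → Set where
  inˡ : (i : Fin a) → SplitView a b (i ↑ˡ b)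
  inʳ : (j : Fin b) → SplitView a b (a ↑ʳ j)

splitView : ∀ a b (x : Fin (a + b)) → SplitView a b x
splitView a b x with splitAt a x in eq
... | inj₁ i with refl ← splitAt⁻¹-↑ˡ eq = inˡ i
... | inj₂ j with refl ← splitAt⁻¹-↑ʳ eq = inʳ j

↑ˡ≢↑ʳ : ∀ {a b} (i : Fin a) (j : Fin b) → i ↑ˡ b ≢ a ↑ʳ j
↑ˡ≢↑ʳ {a} {b} i j eq with () ←
  trans (sym (splitAt-↑ˡ a i b)) (trans (cong (splitAt a) eq) (splitAt-↑ʳ a b j))

module _ (G H : Graph) where

  ↑ˡ-injective′ : Injective _≡_ _≡_ (λ (x : Fin (n G)) → x ↑ˡ n H)
  ↑ˡ-injective′ {x} {y} = ↑ˡ-injective (n H) x y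

  ∪-adjˡ : ∀ x y → Adj (G ∪ H) (x ↑ˡ n H) (y ↑ˡ n H) ≡ Adj G x y
  ∪-adjˡ x y rewrite splitAt-↑ˡ (n G) x (n H) | splitAt-↑ˡ (n G) y (n H) = refl

  ∪-isolatedʳ : Irrelevant (Fin (n H)) → ∀ h y → ¬ Adj (G ∪ H) (n G ↑ʳ h) y
  ∪-isolatedʳ H-single h y with splitView (n G) (n H) y
  ... | inˡ j rewrite splitAt-↑ʳ (n G) (n H) h | splitAt-↑ˡ (n G) j (n H) = λ ()
  ... | inʳ j with refl ← H-single h j = adj-irrefl (G ∪ H)

  ∪-completeWithIsolated : IsComplete G → Irrelevant (Fin (n H)) → ∀ h →
                           IsCompleteWithIsolated (G ∪ H) (n G ↑ʳ h)
  ∪-completeWithIsolated G-complete H-single h x y =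
    go (splitView (n G) (n H) x) (splitView (n G) (n H) y)
    where
    s = n G ↑ʳ h
    ≡s : ∀ j → n G ↑ʳ j ≡ s
    ≡s j = cong (n G ↑ʳ_) (H-single j h)
    go : ∀ {x y} → SplitView (n G) (n H) x → SplitView (n G) (n H) y → Adj (G ∪ H) x y ⇔ Avoiding s x y
    go (inˡ i) (inˡ j) = begin
      Adj (G ∪ H) (i ↑ˡ n H) (j ↑ˡ n H)  ≡⟨ ∪-adjˡ i j ⟩
      Adj G i j                          ≈⟨ G-complete i j ⟩
      i ≢ j                              ≈⟨ ≢⇔≢ ↑ˡ-injective′ i j ⟩
      i ↑ˡ n H ≢ j ↑ˡ n H                ≈⟨ avoiding⇔≢ (↑ˡ≢↑ʳ i h) (↑ˡ≢↑ʳ j h) ⟨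
      Avoiding s (i ↑ˡ n H) (j ↑ˡ n H)   ∎
    go (inˡ i) (inʳ j) = mk⇔ (⊥-elim ∘ ∪-isolatedʳ H-single j _ ∘ adj-sym (G ∪ H))
                             (λ (_ , _ , y≢s) → contradiction (≡s j) y≢s)
    go (inʳ i) _       = mk⇔ (⊥-elim ∘ ∪-isolatedʳ H-single i _)
                             (λ (_ , x≢s , _) → contradiction (≡s i) x≢s)

  ∪-restrict : ∀ {w} → IsCompleteWithIsolated (G ∪ H) w → CompleteWithAtMostOneIsolated G
  ∪-restrict {w} cwi with splitView (n G) (n H) w
  ... | inˡ s = inj₂ (s , λ x y → begin
    Adj G x y                                    ≡⟨ ∪-adjˡ x y ⟨
    Adj (G ∪ H) (x ↑ˡ n H) (y ↑ˡ n H)            ≈⟨ cwi _ _ ⟩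
    Avoiding (s ↑ˡ n H) (x ↑ˡ n H) (y ↑ˡ n H)    ≈⟨ avoiding⇔avoiding ↑ˡ-injective′ s x y ⟨
    Avoiding s x y                               ∎)
  ... | inʳ j = inj₁ λ x y → begin
    Adj G x y                                    ≡⟨ ∪-adjˡ x y ⟨
    Adj (G ∪ H) (x ↑ˡ n H) (y ↑ˡ n H)            ≈⟨ cwi _ _ ⟩
    Avoiding (n G ↑ʳ j) (x ↑ˡ n H) (y ↑ˡ n H)    ≈⟨ avoiding⇔≢ (↑ˡ≢↑ʳ x j) (↑ˡ≢↑ʳ y j) ⟩
    x ↑ˡ n H ≢ y ↑ˡ n H                          ≈⟨ ≢⇔≢ ↑ˡ-injective′ x y ⟨
    x ≢ y                                        ∎

∪-Empty₀-completeWithIsolated : (G : Graph) {s : Fin (n G)} → IsCompleteWithIsolated G s →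
                                IsCompleteWithIsolated (G ∪ Empty 0) (s ↑ˡ 0)
∪-Empty₀-completeWithIsolated G {s} cwi x y = go (splitView (n G) 0 x) (splitView (n G) 0 y)
  where
  go : ∀ {x y} → SplitView (n G) 0 x → SplitView (n G) 0 y →
       Adj (G ∪ Empty 0) x y ⇔ Avoiding (s ↑ˡ 0) x y
  go (inˡ i) (inˡ j) = begin
    Adj (G ∪ Empty 0) (i ↑ˡ 0) (j ↑ˡ 0)  ≡⟨ ∪-adjˡ G (Empty 0) i j ⟩
    Adj G i j                            ≈⟨ cwi i j ⟩
    Avoiding s i j                       ≈⟨ avoiding⇔avoiding (↑ˡ-injective′ G (Empty 0)) s i j ⟩
    Avoiding (s ↑ˡ 0) (i ↑ˡ 0) (j ↑ˡ 0)  ∎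
  go (inˡ _) (inʳ ())
  go (inʳ ()) _

completeWithAtMostOneIsolated⇔≅ : ∀ {G t} → n G ≡ t + 1 →
  CompleteWithAtMostOneIsolated G ⇔ (G ≅ K (t + 1) ⊎ G ≅ (K t ∪ K 1))
completeWithAtMostOneIsolated⇔≅ {G} {t} n≡t+1 = mk⇔
  [ (λ complete → inj₁ (complete⇒≅ n≡t+1 complete (K-complete (t + 1))))
  , (λ (s , cwi) → inj₂ (completeWithIsolated⇒≅ n≡t+1 cwi K∪K₁-cwi)) ]′
  [ (λ φ → inj₁ (complete-pullback φ (K-complete (t + 1))))
  , (λ φ → inj₂ (_ , completeWithIsolated-pullback φ K∪K₁-cwi)) ]′
  where
  K∪K₁-cwi : IsCompleteWithIsolated (K t ∪ K 1) (t ↑ʳ zero)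
  K∪K₁-cwi = ∪-completeWithIsolated (K t) (K 1) (K-complete t) (Fin-irrelevant ℕ.≤-refl) zero

-- The denominator argument of mkℚ is the denominator minus one.
fromℕ : ℕ → ℚ
fromℕ k = mkℚ (+ k) 0 (coprime-sym (1-coprimeTo k))

fromℕ-injective : Injective _≡_ _≡_ fromℕ
fromℕ-injective = ℤ.+-injective ∘ cong ↥_

≤∧≢⇒< : ∀ {p q} → p ≤ℚ q → p ≢ q → p <ℚ q
≤∧≢⇒< p≤q p≢q = ℚ.≰⇒> (p≢q ∘ ℚ.≤-antisym p≤q)

argmin : ∀ {m} → Fin m → (h : Fin m → ℚ) → ∃ λ z → ∀ i → h z ≤ℚ h i
argmin {suc zero}    _ h = zero , λ { zero → ℚ.≤-refl }
argmin {suc (suc m)} _ h with argmin zero (h ∘ suc)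
... | z , z-min with ℚ.≤-total (h zero) (h (suc z))
...   | inj₁ h0≤hz = zero , λ { zero → ℚ.≤-refl ; (suc i) → ℚ.≤-trans h0≤hz (z-min i) }
...   | inj₂ hz≤h0 = suc z , λ { zero → hz≤h0 ; (suc i) → z-min i }

Vec₁-ext : (v w : Vec ℚ 1) → lookup v zero ≡ lookup w zero → v ≡ w
Vec₁-ext (a ∷ []) (b ∷ []) refl = refl

module _ {m} (p : Fin m → Vec ℚ 1) (p-injective : Injective _≡_ _≡_ p) where

  position : Fin m → ℚ
  position i = lookup (p i) zero

  C-D₁-completeWithIsolated-at-minimum : ∀ z → (∀ i → position z ≤ℚ position i) →
                                         IsCompleteWithIsolated (C (D p)) z
  C-D₁-completeWithIsolated-at-minimum z z-min x y = mk⇔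
    (λ (x≢y , v , x→v , y→v) → x≢y , ¬arc-from-minimum x→v , ¬arc-from-minimum y→v)
    (λ (x≢y , x≢z , y≢z) → x≢y , z , arc-to-minimum x≢z , arc-to-minimum y≢z)
    where
    arc-to-minimum : ∀ {x} → x ≢ z → Arc (D p) x z
    arc-to-minimum x≢z zero = ≤∧≢⇒< (z-min _) (λ e → x≢z (sym (p-injective (Vec₁-ext _ _ e))))
    ¬arc-from-minimum : ∀ {x v} → Arc (D p) x v → x ≢ z
    ¬arc-from-minimum {v = v} x→v refl = ℚ.<-irrefl refl (ℚ.<-≤-trans (x→v zero) (z-min v))

  C-D₁-completeWithIsolated : Fin m → ∃ (IsCompleteWithIsolated (C (D p)))
  C-D₁-completeWithIsolated i =
    let z , z-min = argmin i position in z , C-D₁-completeWithIsolated-at-minimum z z-min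

points : ∀ {m} → Fin m → Vec ℚ 1
points i = fromℕ (toℕ i) ∷ []

points-injective : ∀ {m} → Injective _≡_ _≡_ (points {m})
points-injective = toℕ-injective ∘ fromℕ-injective ∘ ∷-injectiveˡ

representable₁ : (G : Graph) {k : ℕ} (c : Fin (n G + k)) →
                 IsCompleteWithIsolated (G ∪ Empty k) c → Representable G 1
representable₁ G {k} c cwi =
  let _ , C-cwi = C-D₁-completeWithIsolated points points-injective c
  in k , n G + k , points , points-injective , completeWithIsolated⇒≅ refl cwi C-cwi

representable₁⇔ : (G : Graph) → Representable G 1 ⇔ CompleteWithAtMostOneIsolated G
representable₁⇔ G = mk⇔ classify
  [ (λ complete → representable₁ G (n G ↑ʳ zero)
                    (∪-completeWithIsolated G (Empty 1) complete (Fin-irrelevant ℕ.≤-refl) zero))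
  , (λ (s , cwi) → representable₁ G (s ↑ˡ 0) (∪-Empty₀-completeWithIsolated G cwi)) ]′
  where
  classify : Representable G 1 → CompleteWithAtMostOneIsolated G
  classify (k , zero , p , _ , φ) = inj₁ λ x → ⊥-elim (¬Fin0 (Bijection.to (_≅_.bij φ) (x ↑ˡ k)))
  classify (k , suc m , p , p-injective , φ) =
    let _ , C-cwi = C-D₁-completeWithIsolated p p-injective zero
    in ∪-restrict G (Empty k) (completeWithIsolated-pullback φ C-cwi)

Vec₀-irrelevant : Irrelevant (Vec ℚ 0)
Vec₀-irrelevant [] [] = refl

representable₀ : (G : Graph) → Irrelevant (Fin (n G)) → Representable G 0
representable₀ G G-single =
  0 , n G + 0 , points₀ , (λ {x} {y} _ → single x y) ,
  record { bij = ⤖-id _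
         ; adj = λ _ _ → mk⇔ (⊥-elim ∘ irrelevant⇒¬Adj (G ∪ Empty 0) single)
                             (⊥-elim ∘ irrelevant⇒¬Adj (C (D points₀)) single) }
  where
  points₀ : Fin (n G + 0) → Vec ℚ 0
  points₀ _ = []
  single : Irrelevant (Fin (n G + 0))
  single x y with splitView (n G) 0 x | splitView (n G) 0 y
  ... | inˡ i | inˡ j = cong (_↑ˡ 0) (G-single i j)

¬representable₀ : (G : Graph) {x y : Fin (n G)} → x ≢ y → ¬ Representable G 0
¬representable₀ G x≢y (k , m , p , p-injective , φ) =
  x≢y (↑ˡ-injective′ G (Empty k) (Bijection.injective (_≅_.bij φ) (p-injective (Vec₀-irrelevant _ _))))

¬representable₀⇔2≤n : (G : Graph) → (¬ Representable G 0) ⇔ 2 ≤ n G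
¬representable₀⇔2≤n G =
  mk⇔ two-vertices (λ 2≤n → let _ , _ , x≢y = Fin-distinct 2≤n in ¬representable₀ G x≢y)
  where
  two-vertices : ¬ Representable G 0 → 2 ≤ n G
  two-vertices ¬rep₀ with 2 ≤? n G
  ... | yes 2≤n = 2≤n
  ... | no 2≰n  = contradiction (representable₀ G (Fin-irrelevant (ℕ.≤-pred (ℕ.≰⇒> 2≰n)))) ¬rep₀

dimPoc₁⇔ : (G : Graph) → DimPoc G 1 ⇔ (Representable G 1 × ¬ Representable G 0)
dimPoc₁⇔ G = mk⇔ (λ (rep₁ , minimal) → rep₁ , minimal 0 (s≤s z≤n))
                 (λ (rep₁ , ¬rep₀) → rep₁ , λ { zero _ → ¬rep₀ ; (suc _) (s≤s ()) })

proposition3p10 : (G : Graph) →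
    DimPoc G 1 ⇔ (Σ ℕ λ t → t ≥ 1 × ((G ≅ K (t + 1)) ⊎ (G ≅ (K t ∪ K 1))))
proposition3p10 G = mk⇔ forward backward
  where
  open Equivalence
  forward : DimPoc G 1 → Σ ℕ λ t → t ≥ 1 × ((G ≅ K (t + 1)) ⊎ (G ≅ (K t ∪ K 1)))
  forward dim =
    let rep₁ , ¬rep₀ = to (dimPoc₁⇔ G) dim
        t , t≥1 , n≡t+1 = to 2≤n⇔n≡t+1 (to (¬representable₀⇔2≤n G) ¬rep₀)
    in t , t≥1 , to (completeWithAtMostOneIsolated⇔≅ n≡t+1) (to (representable₁⇔ G) rep₁)
  backward : (Σ ℕ λ t → t ≥ 1 × ((G ≅ K (t + 1)) ⊎ (G ≅ (K t ∪ K 1)))) → DimPoc G 1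
  backward (t , t≥1 , φ) =
    let n≡t+1 = [ ≅⇒size≡ , ≅⇒size≡ ]′ φ
    in from (dimPoc₁⇔ G)
         ( from (representable₁⇔ G) (from (completeWithAtMostOneIsolated⇔≅ n≡t+1) φ)
         , from (¬representable₀⇔2≤n G) (from 2≤n⇔n≡t+1 (t , t≥1 , n≡t+1)) )
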